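{- Let $(t_n)_{n\ge 0}$ be the Thue–Morse sequence, let $A = \{n \ge 0 : t_n = 0\}$, and for $n \in \mathbb{N}$ let $R_2^{(A)}(n) = |\{(x,y)\in\mathbb{N}^2 : x,y\in A,\ x+y=n,\ x<y\}|$. Then for all integers $t \geq 1$: (a) $R_2^{(A)}(2^t-1) = 0$ if $t$ is odd, and $R_2^{(A)}(2^t-1) = 2^{t-2}$ if $t$ is even; (b) $R_2^{(A)}(2^t+1) = (2^{t-2}+2)/3$ if $t$ is even, and $R_2^{(A)}(2^t+1) = (2^{t-1}+2)/3$ if $t$ is odd.
   Context: $\mathbb{N}=\{0,1,2,\ldots\}$. The Thue–Morse sequence is defined by $t_0=0$, $t_{2n}=t_n$, $t_{2n+1}=1-t_n$ for $n\ge 0$; equivalently $t_n$ is the parity of the number of $1$'s in the binary representation of $n$. -}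

module Defs where

open import Data.Nat using (ℕ; zero; suc; _+_; _∸_; _<_; _<?_; _%_; _/_)
open import Data.List using (List; length; filter; upTo)
open import Data.Product using (_×_)
open import Relation.Nullary.Decidable using (_×-dec_)
open import Data.Nat.Properties using (_≟_)

-- tmFuel k n : parity of the number of 1's in the binary expansion of n,
-- correct whenever n < 2^k (k halvings suffice).  Uses t_{2m+r} = (r + t_m) mod 2.
tmFuel : ℕ → ℕ → ℕ
tmFuel zero    n = 0
tmFuel (suc k) n = (n % 2 + tmFuel k (n / 2)) % 2

-- Thue–Morse sequence t_n  (n < 2^n, so fuel n suffices)
t : ℕ → ℕ
t n = tmFuel n n

InA : ℕ → Set
InA n = t n ≡ 0
  where open import Relation.Binary.PropositionalEquality using (_≡_)

-- R₂^{(A)}(n) = #{(x,y) : x,y ∈ A, x + y = n, x < y}; such pairs are determined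
-- by x (with y = n ∸ x, x ≤ n), so we count x ∈ [0, n) with x ∈ A, n∸x ∈ A, x < n∸x.
R2 : ℕ → ℕ
R2 n = length (filter (λ x → (t x ≟ 0) ×-dec ((t (n ∸ x) ≟ 0) ×-dec (x <? n ∸ x))) (upTo n))

module Submission where

-- Let χA be the indicator of A and reps a b n the number of ordered pairs (x, y) with
-- x + y = n, χA x = a and χA y = b.  Since t (2q) = t q and t (2q+1) = 1 - t q, splitting x
-- by parity gives
--   reps a b (2m+1) = reps a (not b) m + reps (not a) b m,
--   reps a b (2m+2) = reps a b (m+1) + reps (not a) (not b) m.
-- For x < 2^k, 2^k - 1 - x flips the k low bits of x, so t (2^k - 1 - x) ≡ t x + k (mod 2)
-- and reps a b (2^k - 1) is 0 or 2^(k-1).  For odd n no pair has x = y, so by the symmetry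
-- x ↔ y, 2 R2(n) = reps true true n.  This gives (a) at once; for (b) it gives
-- R2(2^k + 1) = reps false true (2^(k-1)), which by the second recursion stays put from 4^i
-- to 2·4^i and grows by 4^i from 2·4^i to 4^(i+1); hence 3 reps false true (4^i) = 4^i + 2.

open import Defs
open import Data.Bool using (Bool; true; false; not; _∧_)
import Data.Bool.Properties as Bool
open import Data.Empty using (⊥-elim)
open import Data.List using (length; filter; applyUpTo)
open import Data.Nat using (ℕ; zero; suc; _+_; _*_; _∸_; _^_; _/_; _%_; _≤_; _<_; _≡ᵇ_; _<?_; z≤n; s≤s; s≤s⁻¹; z<s; s<s)
open import Data.Nat.DivMod
open import Data.Nat.GeneralisedArithmetic using (fold)
open import Data.Nat.Properties
open import Data.Nat.Tactic.RingSolver using (solve-∀)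
open import Data.Product using (_×_; _,_)
open import Function using (_∘_)
open import Relation.Binary using (tri<; tri≈; tri>)
open import Relation.Binary.PropositionalEquality
open import Relation.Nullary using (does)
open import Relation.Nullary.Decidable using (dec-true; dec-false)
open import Relation.Unary using (Pred; Decidable)
open import Algebra.Properties.CommutativeSemigroup +-commutativeSemigroup using (interchange; xy∙z≈xz∙y; x∙yz≈y∙xz)

data Parity : ℕ → Set where
  even : ∀ q → Parity (2 * q)
  odd  : ∀ q → Parity (suc (2 * q))

parity : ∀ n → Parity n
parity zero = even 0
parity (suc n) with parity n
... | even q = odd q
... | odd q  = subst Parity (*-suc 2 q) (even (suc q))

2*n%2≡0 : ∀ n → 2 * n % 2 ≡ 0
2*n%2≡0 n = trans (cong (_% 2) (*-comm 2 n)) (m*n%n≡0 n 2)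

2*n/2≡n : ∀ n → 2 * n / 2 ≡ n
2*n/2≡n n = trans (cong (_/ 2) (*-comm 2 n)) (m*n/n≡m n 2)

1+2*n%2≡1 : ∀ n → suc (2 * n) % 2 ≡ 1
1+2*n%2≡1 n = trans (cong (λ m → suc m % 2) (*-comm 2 n)) ([m+kn]%n≡m%n 1 n 2)

1+2*n/2≡n : ∀ n → suc (2 * n) / 2 ≡ n
1+2*n/2≡n n = trans (+-distrib-/ 1 (2 * n) (subst (λ r → 1 + r < 2) (sym (2*n%2≡0 n)) ≤-refl)) (2*n/2≡n n)

2*m≢1+2*n : ∀ m n → 2 * m ≢ suc (2 * n)
2*m≢1+2*n m n eq = 0≢1+n (trans (sym (2*n%2≡0 m)) (trans (cong (_% 2) eq) (1+2*n%2≡1 n)))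

1+2*m∸2*q≡1+2*[m∸q] : ∀ {m q} → q ≤ m → suc (2 * m) ∸ 2 * q ≡ suc (2 * (m ∸ q))
1+2*m∸2*q≡1+2*[m∸q] {m} {q} q≤m =
  trans (+-∸-assoc 1 (*-monoʳ-≤ 2 q≤m)) (cong suc (sym (*-distribˡ-∸ 2 m q)))

2*[1+m]∸[1+2*q]≡1+2*[m∸q] : ∀ {m q} → q ≤ m → 2 * suc m ∸ suc (2 * q) ≡ suc (2 * (m ∸ q))
2*[1+m]∸[1+2*q]≡1+2*[m∸q] {m} {q} q≤m =
  trans (cong (_∸ suc (2 * q)) (*-suc 2 m)) (1+2*m∸2*q≡1+2*[m∸q] q≤m)

x≢1+2*m∸x : ∀ m {x} → x ≤ suc (2 * m) → x ≢ suc (2 * m) ∸ x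
x≢1+2*m∸x m {x} x≤n x≡n∸x = 2*m≢1+2*n x m (begin
  2 * x                 ≡⟨ cong (x +_) (+-identityʳ x) ⟩
  x + x                 ≡⟨ cong (x +_) x≡n∸x ⟩
  x + (suc (2 * m) ∸ x) ≡⟨ m+[n∸m]≡n x≤n ⟩
  suc (2 * m)           ∎)
  where open ≡-Reasoning

suc[2^k∸1]≡2^k : ∀ k → suc (2 ^ k ∸ 1) ≡ 2 ^ k
suc[2^k∸1]≡2^k k = m+[n∸m]≡n (m^n>0 2 k)

2^[1+j]∸1≡1+2*[2^j∸1] : ∀ j → 2 ^ suc j ∸ 1 ≡ suc (2 * (2 ^ j ∸ 1))
2^[1+j]∸1≡1+2*[2^j∸1] j =
  trans (cong (λ m → 2 * m ∸ 1) (sym (suc[2^k∸1]≡2^k j))) (cong (_∸ 1) (*-suc 2 (2 ^ j ∸ 1)))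

fold-not-comm : ∀ b k → fold (not b) not k ≡ not (fold b not k)
fold-not-comm b zero    = refl
fold-not-comm b (suc k) = cong not (fold-not-comm b k)

fold-not-even : ∀ b i → fold b not (2 * i) ≡ b
fold-not-even b zero    = refl
fold-not-even b (suc i) = trans (cong (fold b not) (*-suc 2 i)) (trans (Bool.not-involutive _) (fold-not-even b i))

-- Indicators and finite sums

𝟙 : Bool → ℕ
𝟙 true  = 1
𝟙 false = 0

δ : Bool → Bool → ℕ
δ u v = 𝟙 (does (u Bool.≟ v))

δ-not : ∀ u v → δ (not u) v ≡ δ u (not v)
δ-not false false = refl
δ-not false true  = refl
δ-not true  false = refl
δ-not true  true  = refl

δ-+-δ-not : ∀ u v → δ u v + δ (not u) v ≡ 1
δ-+-δ-not false false = refl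
δ-+-δ-not false true  = refl
δ-+-δ-not true  false = refl
δ-+-δ-not true  true  = refl

δ-subst : ∀ u v (g : Bool → ℕ) → δ u v * g u ≡ δ u v * g v
δ-subst false false g = refl
δ-subst false true  g = refl
δ-subst true  false g = refl
δ-subst true  true  g = refl

𝟙<?-+-𝟙>? : ∀ {x y} → x ≢ y → 𝟙 (does (x <? y)) + 𝟙 (does (y <? x)) ≡ 1
𝟙<?-+-𝟙>? {x} {y} x≢y with <-cmp x y
... | tri< x<y _ y≮x rewrite dec-true (x <? y) x<y | dec-false (y <? x) y≮x = refl
... | tri≈ _ x≡y _ = ⊥-elim (x≢y x≡y)
... | tri> x≮y _ y<x rewrite dec-false (x <? y) x≮y | dec-true (y <? x) y<x = refl

∑< : ℕ → (ℕ → ℕ) → ℕ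
∑< zero    f = 0
∑< (suc n) f = f 0 + ∑< n (λ x → f (suc x))

syntax ∑< n (λ x → e) = ∑[ x < n ] e

∑-cong : ∀ n {f g : ℕ → ℕ} → (∀ {x} → x < n → f x ≡ g x) → ∑< n f ≡ ∑< n g
∑-cong zero    f≗g = refl
∑-cong (suc n) f≗g = cong₂ _+_ (f≗g z<s) (∑-cong n (λ x<n → f≗g (s<s x<n)))

∑-+ : ∀ n (f g : ℕ → ℕ) → ∑[ x < n ] (f x + g x) ≡ ∑< n f + ∑< n g
∑-+ zero    f g = refl
∑-+ (suc n) f g = trans (cong (f 0 + g 0 +_) (∑-+ n _ _)) (interchange (f 0) (g 0) _ _)

∑-*ˡ : ∀ n c (f : ℕ → ℕ) → ∑[ x < n ] (c * f x) ≡ c * ∑< n f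
∑-*ˡ zero    c f = sym (*-zeroʳ c)
∑-*ˡ (suc n) c f = trans (cong (c * f 0 +_) (∑-*ˡ n c _)) (sym (*-distribˡ-+ c (f 0) _))

∑-const : ∀ n c → ∑[ _ < n ] c ≡ n * c
∑-const zero    c = refl
∑-const (suc n) c = cong (c +_) (∑-const n c)

∑-suc : ∀ n (f : ℕ → ℕ) → ∑< (suc n) f ≡ ∑< n f + f n
∑-suc zero    f = +-comm (f 0) 0
∑-suc (suc n) f = trans (cong (f 0 +_) (∑-suc n _)) (sym (+-assoc (f 0) _ _))

∑-reverse : ∀ n (f : ℕ → ℕ) → ∑< n f ≡ ∑[ x < n ] f (n ∸ suc x)
∑-reverse zero    f = refl
∑-reverse (suc n) f = begin
  ∑< (suc n) f                       ≡⟨ ∑-suc n f ⟩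
  ∑< n f + f n                       ≡⟨ +-comm _ (f n) ⟩
  f n + ∑< n f                       ≡⟨ cong (f n +_) (∑-reverse n f) ⟩
  f n + ∑[ x < n ] f (n ∸ suc x)     ∎
  where open ≡-Reasoning

∑-split-even : ∀ n (f : ℕ → ℕ) →
  ∑< (2 * n) f ≡ ∑[ q < n ] f (2 * q) + ∑[ q < n ] f (suc (2 * q))
∑-split-even zero    f = refl
∑-split-even (suc n) f = begin
  ∑< (2 * suc n) f
    ≡⟨ cong (λ m → ∑< m f) (*-suc 2 n) ⟩
  f 0 + (f 1 + ∑[ x < 2 * n ] f (2 + x))
    ≡⟨ cong (λ s → f 0 + (f 1 + s)) (∑-split-even n _) ⟩
  f 0 + (f 1 + (evens + odds))
    ≡⟨ cong (f 0 +_) (x∙yz≈y∙xz (f 1) evens odds) ⟩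
  f 0 + (evens + (f 1 + odds))
    ≡⟨ +-assoc (f 0) evens _ ⟨
  (f 0 + evens) + (f 1 + odds)
    ≡⟨ cong₂ (λ s s′ → (f 0 + s) + (f 1 + s′))
             (∑-cong n (λ {q} _ → cong f (*-suc 2 q))) (∑-cong n (λ {q} _ → cong (f ∘ suc) (*-suc 2 q))) ⟨
  ∑[ q < suc n ] f (2 * q) + ∑[ q < suc n ] f (suc (2 * q)) ∎
  where
  open ≡-Reasoning
  evens = ∑[ q < n ] f (2 + 2 * q)
  odds  = ∑[ q < n ] f (3 + 2 * q)

∑-split-odd : ∀ n (f : ℕ → ℕ) →
  ∑< (suc (2 * n)) f ≡ ∑[ q < suc n ] f (2 * q) + ∑[ q < n ] f (suc (2 * q))
∑-split-odd n f = begin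
  ∑< (suc (2 * n)) f                   ≡⟨ ∑-suc (2 * n) f ⟩
  ∑< (2 * n) f + f (2 * n)             ≡⟨ cong (_+ f (2 * n)) (∑-split-even n f) ⟩
  evens + odds + f (2 * n)             ≡⟨ xy∙z≈xz∙y evens odds (f (2 * n)) ⟩
  evens + f (2 * n) + odds             ≡⟨ cong (_+ odds) (∑-suc n (λ q → f (2 * q))) ⟨
  ∑[ q < suc n ] f (2 * q) + odds      ∎
  where
  open ≡-Reasoning
  evens = ∑[ q < n ] f (2 * q)
  odds  = ∑[ q < n ] f (suc (2 * q))

2*∑[x<n∸x]≡∑ : ∀ m (f : ℕ → ℕ) → (∀ {x} → x ≤ suc (2 * m) → f (suc (2 * m) ∸ x) ≡ f x) →
  2 * ∑[ x < suc (suc (2 * m)) ] (f x * 𝟙 (does (x <? suc (2 * m) ∸ x))) ≡ ∑< (suc (suc (2 * m))) f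
2*∑[x<n∸x]≡∑ m f f-symmetric = begin
  2 * below                                      ≡⟨ cong (below +_) (+-identityʳ below) ⟩
  below + below                                  ≡⟨ cong (below +_) reflect ⟩
  below + above                                  ≡⟨ ∑-+ (suc n) (λ x → f x * [x<y] x) (λ x → f x * [y<x] x) ⟨
  ∑[ x < suc n ] (f x * [x<y] x + f x * [y<x] x) ≡⟨ ∑-cong (suc n) split ⟩
  ∑< (suc n) f                                   ∎
  where
  open ≡-Reasoning
  n = suc (2 * m)
  [x<y] [y<x] : ℕ → ℕ
  [x<y] x = 𝟙 (does (x <? n ∸ x))
  [y<x] x = 𝟙 (does (n ∸ x <? x))
  below above : ℕ
  below = ∑[ x < suc n ] (f x * [x<y] x)
  above = ∑[ x < suc n ] (f x * [y<x] x)
  reflect : below ≡ above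
  reflect = trans (∑-reverse (suc n) (λ x → f x * [x<y] x)) (∑-cong (suc n) mirror)
    where
    mirror : ∀ {x} → x < suc n → f (n ∸ x) * [x<y] (n ∸ x) ≡ f x * [y<x] x
    mirror {x} x<1+n rewrite m∸[m∸n]≡n (s≤s⁻¹ x<1+n) = cong (_* [y<x] x) (f-symmetric (s≤s⁻¹ x<1+n))
  split : ∀ {x} → x < suc n → f x * [x<y] x + f x * [y<x] x ≡ f x
  split {x} x<1+n = begin
    f x * [x<y] x + f x * [y<x] x  ≡⟨ *-distribˡ-+ (f x) ([x<y] x) ([y<x] x) ⟨
    f x * ([x<y] x + [y<x] x)      ≡⟨ cong (f x *_) (𝟙<?-+-𝟙>? (x≢1+2*m∸x m (s≤s⁻¹ x<1+n))) ⟩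
    f x * 1                        ≡⟨ *-identityʳ (f x) ⟩
    f x                            ∎

length-filter-applyUpTo : ∀ {ℓ} {P : Pred ℕ ℓ} (P? : Decidable P) f n →
  length (filter P? (applyUpTo f n)) ≡ ∑[ x < n ] 𝟙 (does (P? (f x)))
length-filter-applyUpTo P? f zero = refl
length-filter-applyUpTo P? f (suc n) with does (P? (f 0))
... | true  = cong suc (length-filter-applyUpTo P? (f ∘ suc) n)
... | false = length-filter-applyUpTo P? (f ∘ suc) n

-- The Thue–Morse sequence

tmFuel-zero : ∀ k → tmFuel k 0 ≡ 0
tmFuel-zero zero = refl
tmFuel-zero (suc k) rewrite tmFuel-zero k = refl

n≤1+k⇒n/2≤k : ∀ {n k} → n ≤ suc k → n / 2 ≤ k
n≤1+k⇒n/2≤k {zero} _ = z≤n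
n≤1+k⇒n/2≤k {suc n} n≤1+k = s≤s⁻¹ (<-≤-trans (m/n<m (suc n) 2 ≤-refl) n≤1+k)

tmFuel-irrelevant : ∀ {k l n} → n ≤ k → n ≤ l → tmFuel k n ≡ tmFuel l n
tmFuel-irrelevant {zero} {l} z≤n _ = sym (tmFuel-zero l)
tmFuel-irrelevant {suc k} {zero} _ z≤n = tmFuel-zero (suc k)
tmFuel-irrelevant {suc k} {suc l} {n} n≤k n≤l =
  cong (λ r → (n % 2 + r) % 2) (tmFuel-irrelevant (n≤1+k⇒n/2≤k n≤k) (n≤1+k⇒n/2≤k n≤l))

t-unfold : ∀ n → t n ≡ (n % 2 + t (n / 2)) % 2
t-unfold zero = refl
t-unfold (suc n) = cong (λ r → (suc n % 2 + r) % 2) (tmFuel-irrelevant {k = n} (n≤1+k⇒n/2≤k {suc n} ≤-refl) ≤-refl)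

t<2 : ∀ n → t n < 2
t<2 zero = s≤s z≤n
t<2 (suc n) = m%n<n (suc n % 2 + tmFuel n (suc n / 2)) 2

t-double : ∀ n → t (2 * n) ≡ t n
t-double n = begin
  t (2 * n)                          ≡⟨ t-unfold (2 * n) ⟩
  (2 * n % 2 + t (2 * n / 2)) % 2    ≡⟨ cong₂ (λ r m → (r + t m) % 2) (2*n%2≡0 n) (2*n/2≡n n) ⟩
  t n % 2                            ≡⟨ m<n⇒m%n≡m (t<2 n) ⟩
  t n                                ∎
  where open ≡-Reasoning

t-suc-double : ∀ n → t (suc (2 * n)) ≡ (1 + t n) % 2
t-suc-double n = trans (t-unfold (suc (2 * n)))
  (cong₂ (λ r m → (r + t m) % 2) (1+2*n%2≡1 n) (1+2*n/2≡n n))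

χA : ℕ → Bool
χA n = t n ≡ᵇ 0

χA-double : ∀ n → χA (2 * n) ≡ χA n
χA-double n = cong (_≡ᵇ 0) (t-double n)

χA-suc-double : ∀ n → χA (suc (2 * n)) ≡ not (χA n)
χA-suc-double n rewrite t-suc-double n with t n | t<2 n
... | 0 | _ = refl
... | 1 | _ = refl
... | suc (suc _) | s≤s (s≤s ())

χA-complement : ∀ k {x y} → suc (x + y) ≡ 2 ^ k → χA y ≡ fold (χA x) not k
χA-complement zero {zero} {zero} _ = refl
χA-complement (suc k) {x} {y} x+y+1≡2^[1+k] with parity x | parity y
... | even a | even b = ⊥-elim (2*m≢1+2*n (2 ^ k) (a + b)
      (sym (trans (cong suc (*-distribˡ-+ 2 a b)) x+y+1≡2^[1+k])))
... | odd a | odd b = ⊥-elim (2*m≢1+2*n (2 ^ k) (suc (a + b))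
      (sym (trans (odd+odd a b) x+y+1≡2^[1+k])))
  where
  odd+odd : ∀ a b → suc (2 * suc (a + b)) ≡ suc (suc (2 * a) + suc (2 * b))
  odd+odd = solve-∀
... | even a | odd b = begin
  χA (suc (2 * b))          ≡⟨ χA-suc-double b ⟩
  not (χA b)                ≡⟨ cong not (χA-complement k {a} {b} (halve (even+odd a b))) ⟩
  not (fold (χA a) not k)   ≡⟨ cong (λ c → not (fold c not k)) (χA-double a) ⟨
  fold (χA (2 * a)) not (suc k) ∎
  where
  open ≡-Reasoning
  even+odd : ∀ a b → 2 * suc (a + b) ≡ suc (2 * a + suc (2 * b))
  even+odd = solve-∀
  halve : ∀ {m} → 2 * suc m ≡ suc (2 * a + suc (2 * b)) → suc m ≡ 2 ^ k
  halve e = *-cancelˡ-≡ _ _ 2 (trans e x+y+1≡2^[1+k])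
... | odd a | even b = begin
  χA (2 * b)                          ≡⟨ χA-double b ⟩
  χA b                                ≡⟨ χA-complement k {a} {b} (halve (odd+even a b)) ⟩
  fold (χA a) not k                   ≡⟨ Bool.not-involutive _ ⟨
  not (not (fold (χA a) not k))       ≡⟨ cong not (fold-not-comm (χA a) k) ⟨
  not (fold (not (χA a)) not k)       ≡⟨ cong (λ c → not (fold c not k)) (χA-suc-double a) ⟨
  fold (χA (suc (2 * a))) not (suc k) ∎
  where
  open ≡-Reasoning
  odd+even : ∀ a b → 2 * suc (a + b) ≡ suc (suc (2 * a) + 2 * b)
  odd+even = solve-∀
  halve : ∀ {m} → 2 * suc m ≡ suc (suc (2 * a) + 2 * b) → suc m ≡ 2 ^ k
  halve e = *-cancelˡ-≡ _ _ 2 (trans e x+y+1≡2^[1+k])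

χA-balanced : ∀ a m → ∑[ x < 2 * m ] δ (χA x) a ≡ m
χA-balanced a m = begin
  ∑[ x < 2 * m ] δ (χA x) a
    ≡⟨ ∑-split-even m (λ x → δ (χA x) a) ⟩
  ∑[ q < m ] δ (χA (2 * q)) a + ∑[ q < m ] δ (χA (suc (2 * q))) a
    ≡⟨ ∑-+ m (λ q → δ (χA (2 * q)) a) (λ q → δ (χA (suc (2 * q))) a) ⟨
  ∑[ q < m ] (δ (χA (2 * q)) a + δ (χA (suc (2 * q))) a)
    ≡⟨ ∑-cong m (λ {q} _ → pair-sum q) ⟩
  ∑[ _ < m ] 1
    ≡⟨ ∑-const m 1 ⟩
  m * 1
    ≡⟨ *-identityʳ m ⟩
  m ∎
  where
  open ≡-Reasoning
  pair-sum : ∀ q → δ (χA (2 * q)) a + δ (χA (suc (2 * q))) a ≡ 1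
  pair-sum q rewrite χA-double q | χA-suc-double q = δ-+-δ-not (χA q) a

-- Ordered representations

reps : Bool → Bool → ℕ → ℕ
reps a b n = ∑[ x < suc n ] (δ (χA x) a * δ (χA (n ∸ x)) b)

reps-comm : ∀ a b n → reps a b n ≡ reps b a n
reps-comm a b n = trans (∑-reverse (suc n) (λ x → δ (χA x) a * δ (χA (n ∸ x)) b)) (∑-cong (suc n) swap)
  where
  swap : ∀ {x} → x < suc n → δ (χA (n ∸ x)) a * δ (χA (n ∸ (n ∸ x))) b ≡ δ (χA x) b * δ (χA (n ∸ x)) a
  swap {x} x<1+n rewrite m∸[m∸n]≡n (s≤s⁻¹ x<1+n) = *-comm (δ (χA (n ∸ x)) a) (δ (χA x) b)

reps-odd : ∀ a b m → reps a b (suc (2 * m)) ≡ reps a (not b) m + reps (not a) b m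
reps-odd a b m = begin
  ∑< (suc (suc (2 * m))) F
    ≡⟨ cong (λ k → ∑< k F) (*-suc 2 m) ⟨
  ∑< (2 * suc m) F
    ≡⟨ ∑-split-even (suc m) F ⟩
  ∑[ q < suc m ] F (2 * q) + ∑[ q < suc m ] F (suc (2 * q))
    ≡⟨ cong₂ _+_ (∑-cong (suc m) even-x) (∑-cong (suc m) odd-x) ⟩
  reps a (not b) m + reps (not a) b m ∎
  where
  open ≡-Reasoning
  F : ℕ → ℕ
  F x = δ (χA x) a * δ (χA (suc (2 * m) ∸ x)) b
  even-x : ∀ {q} → q < suc m → F (2 * q) ≡ δ (χA q) a * δ (χA (m ∸ q)) (not b)
  even-x {q} q<1+m rewrite χA-double q | 1+2*m∸2*q≡1+2*[m∸q] (s≤s⁻¹ q<1+m) | χA-suc-double (m ∸ q) =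
    cong (δ (χA q) a *_) (δ-not (χA (m ∸ q)) b)
  odd-x : ∀ {q} → q < suc m → F (suc (2 * q)) ≡ δ (χA q) (not a) * δ (χA (m ∸ q)) b
  odd-x {q} _ rewrite χA-suc-double q | sym (*-distribˡ-∸ 2 m q) | χA-double (m ∸ q) =
    cong (_* δ (χA (m ∸ q)) b) (δ-not (χA q) a)

reps-even : ∀ a b m → reps a b (2 * suc m) ≡ reps a b (suc m) + reps (not a) (not b) m
reps-even a b m = begin
  ∑< (suc (2 * suc m)) F
    ≡⟨ ∑-split-odd (suc m) F ⟩
  ∑[ q < suc (suc m) ] F (2 * q) + ∑[ q < suc m ] F (suc (2 * q))
    ≡⟨ cong₂ _+_ (∑-cong (suc (suc m)) even-x) (∑-cong (suc m) odd-x) ⟩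
  reps a b (suc m) + reps (not a) (not b) m ∎
  where
  open ≡-Reasoning
  F : ℕ → ℕ
  F x = δ (χA x) a * δ (χA (2 * suc m ∸ x)) b
  even-x : ∀ {q} → q < suc (suc m) → F (2 * q) ≡ δ (χA q) a * δ (χA (suc m ∸ q)) b
  even-x {q} _ rewrite χA-double q | sym (*-distribˡ-∸ 2 (suc m) q) | χA-double (suc m ∸ q) = refl
  odd-x : ∀ {q} → q < suc m → F (suc (2 * q)) ≡ δ (χA q) (not a) * δ (χA (m ∸ q)) (not b)
  odd-x {q} q<1+m rewrite χA-suc-double q | 2*[1+m]∸[1+2*q]≡1+2*[m∸q] (s≤s⁻¹ q<1+m) | χA-suc-double (m ∸ q) =
    cong₂ _*_ (δ-not (χA q) a) (δ-not (χA (m ∸ q)) b)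

reps-complement : ∀ a b k → reps a b (2 ^ k ∸ 1) ≡ δ (fold a not k) b * ∑[ x < 2 ^ k ] δ (χA x) a
reps-complement a b k = begin
  reps a b n
    ≡⟨ ∑-cong (suc n) term ⟩
  ∑[ x < suc n ] (δ (fold a not k) b * δ (χA x) a)
    ≡⟨ ∑-*ˡ (suc n) (δ (fold a not k) b) (λ x → δ (χA x) a) ⟩
  δ (fold a not k) b * ∑[ x < suc n ] δ (χA x) a
    ≡⟨ cong (λ m → δ (fold a not k) b * ∑[ x < m ] δ (χA x) a) (suc[2^k∸1]≡2^k k) ⟩
  δ (fold a not k) b * ∑[ x < 2 ^ k ] δ (χA x) a ∎
  where
  open ≡-Reasoning
  n = 2 ^ k ∸ 1
  term : ∀ {x} → x < suc n → δ (χA x) a * δ (χA (n ∸ x)) b ≡ δ (fold a not k) b * δ (χA x) a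
  term {x} x<1+n = begin
    δ (χA x) a * δ (χA (n ∸ x)) b
      ≡⟨ cong (λ c → δ (χA x) a * δ c b) (χA-complement k {x} {n ∸ x} x+y+1≡2^k) ⟩
    δ (χA x) a * δ (fold (χA x) not k) b
      ≡⟨ δ-subst (χA x) a (λ c → δ (fold c not k) b) ⟩
    δ (χA x) a * δ (fold a not k) b
      ≡⟨ *-comm (δ (χA x) a) _ ⟩
    δ (fold a not k) b * δ (χA x) a ∎
    where
    x+y+1≡2^k : suc (x + (n ∸ x)) ≡ 2 ^ k
    x+y+1≡2^k = trans (cong suc (m+[n∸m]≡n (s≤s⁻¹ x<1+n))) (suc[2^k∸1]≡2^k k)

𝟙-∧-∧ : ∀ u v w → 𝟙 (u ∧ (v ∧ w)) ≡ δ u true * δ v true * 𝟙 w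
𝟙-∧-∧ false v     w     = refl
𝟙-∧-∧ true  false w     = refl
𝟙-∧-∧ true  true  false = refl
𝟙-∧-∧ true  true  true  = refl

R2-as-sum : ∀ n → R2 n ≡ ∑[ x < suc n ] (δ (χA x) true * δ (χA (n ∸ x)) true * 𝟙 (does (x <? n ∸ x)))
R2-as-sum n = begin
  R2 n
    ≡⟨ length-filter-applyUpTo _ (λ x → x) n ⟩
  ∑[ x < n ] 𝟙 (χA x ∧ (χA (n ∸ x) ∧ does (x <? n ∸ x)))
    ≡⟨ ∑-cong n (λ {x} _ → 𝟙-∧-∧ (χA x) _ _) ⟩
  ∑< n f
    ≡⟨ +-identityʳ _ ⟨
  ∑< n f + 0
    ≡⟨ cong (∑< n f +_) (diagonal-end) ⟨
  ∑< n f + f n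
    ≡⟨ ∑-suc n f ⟨
  ∑< (suc n) f ∎
  where
  open ≡-Reasoning
  f : ℕ → ℕ
  f x = δ (χA x) true * δ (χA (n ∸ x)) true * 𝟙 (does (x <? n ∸ x))
  diagonal-end : f n ≡ 0
  diagonal-end rewrite n∸n≡0 n = *-zeroʳ (δ (χA n) true * δ (χA 0) true)

2*R2≡reps : ∀ m → 2 * R2 (suc (2 * m)) ≡ reps true true (suc (2 * m))
2*R2≡reps m = trans (cong (2 *_) (R2-as-sum n)) (2*∑[x<n∸x]≡∑ m f f-symmetric)
  where
  n = suc (2 * m)
  f : ℕ → ℕ
  f x = δ (χA x) true * δ (χA (n ∸ x)) true
  f-symmetric : ∀ {x} → x ≤ n → f (n ∸ x) ≡ f x
  f-symmetric {x} x≤n rewrite m∸[m∸n]≡n x≤n = *-comm (δ (χA (n ∸ x)) true) (δ (χA x) true)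

-- Sums of the form 2^k ± 1

2*R2[2^[1+j]∸1] : ∀ j → 2 * R2 (2 ^ suc j ∸ 1) ≡ δ (fold true not (suc j)) true * 2 ^ j
2*R2[2^[1+j]∸1] j = begin
  2 * R2 (2 ^ suc j ∸ 1)
    ≡⟨ cong (λ n → 2 * R2 n) (2^[1+j]∸1≡1+2*[2^j∸1] j) ⟩
  2 * R2 (suc (2 * (2 ^ j ∸ 1)))
    ≡⟨ 2*R2≡reps (2 ^ j ∸ 1) ⟩
  reps true true (suc (2 * (2 ^ j ∸ 1)))
    ≡⟨ cong (reps true true) (2^[1+j]∸1≡1+2*[2^j∸1] j) ⟨
  reps true true (2 ^ suc j ∸ 1)
    ≡⟨ reps-complement true true (suc j) ⟩
  δ (fold true not (suc j)) true * ∑[ x < 2 * 2 ^ j ] δ (χA x) true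
    ≡⟨ cong (δ (fold true not (suc j)) true *_) (χA-balanced true (2 ^ j)) ⟩
  δ (fold true not (suc j)) true * 2 ^ j ∎
  where open ≡-Reasoning

R2[2^k∸1]-odd : ∀ i → R2 (2 ^ suc (2 * i) ∸ 1) ≡ 0
R2[2^k∸1]-odd i = *-cancelˡ-≡ _ 0 2 (trans (2*R2[2^[1+j]∸1] (2 * i)) δ≡0)
  where
  δ≡0 : δ (fold true not (suc (2 * i))) true * 2 ^ (2 * i) ≡ 0
  δ≡0 rewrite fold-not-even true i = refl

R2[2^k∸1]-even : ∀ i → R2 (2 ^ suc (suc (2 * i)) ∸ 1) ≡ 2 ^ (2 * i)
R2[2^k∸1]-even i = *-cancelˡ-≡ _ _ 2 (trans (2*R2[2^[1+j]∸1] (suc (2 * i))) δ≡1)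
  where
  δ≡1 : δ (fold true not (suc (suc (2 * i)))) true * 2 ^ suc (2 * i) ≡ 2 * 2 ^ (2 * i)
  δ≡1 rewrite fold-not-even true i = +-identityʳ _

R2[2^[1+j]+1] : ∀ j → R2 (2 ^ suc j + 1) ≡ reps false true (2 ^ j)
R2[2^[1+j]+1] j = *-cancelˡ-≡ _ _ 2 (begin
  2 * R2 (2 ^ suc j + 1)                     ≡⟨ cong (λ n → 2 * R2 n) (+-comm (2 ^ suc j) 1) ⟩
  2 * R2 (suc (2 * 2 ^ j))                   ≡⟨ 2*R2≡reps (2 ^ j) ⟩
  reps true true (suc (2 * 2 ^ j))           ≡⟨ reps-odd true true (2 ^ j) ⟩
  reps true false (2 ^ j) + r                ≡⟨ cong (_+ r) (reps-comm true false (2 ^ j)) ⟩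
  r + r                                      ≡⟨ cong (r +_) (+-identityʳ r) ⟨
  2 * r                                      ∎)
  where
  open ≡-Reasoning
  r = reps false true (2 ^ j)

reps[2^[1+j]] : ∀ j → reps false true (2 ^ suc j) ≡ reps false true (2 ^ j) + reps true false (2 ^ j ∸ 1)
reps[2^[1+j]] j = begin
  reps false true (2 * 2 ^ j)
    ≡⟨ cong (λ m → reps false true (2 * m)) (suc[2^k∸1]≡2^k j) ⟨
  reps false true (2 * suc (2 ^ j ∸ 1))
    ≡⟨ reps-even false true (2 ^ j ∸ 1) ⟩
  reps false true (suc (2 ^ j ∸ 1)) + reps true false (2 ^ j ∸ 1)
    ≡⟨ cong (λ m → reps false true m + reps true false (2 ^ j ∸ 1)) (suc[2^k∸1]≡2^k j) ⟩
  reps false true (2 ^ j) + reps true false (2 ^ j ∸ 1) ∎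
  where open ≡-Reasoning

reps[2^[1+2i]] : ∀ i → reps false true (2 ^ suc (2 * i)) ≡ reps false true (2 ^ (2 * i))
reps[2^[1+2i]] i = begin
  reps false true (2 ^ suc (2 * i))
    ≡⟨ reps[2^[1+j]] (2 * i) ⟩
  r + reps true false (2 ^ (2 * i) ∸ 1)
    ≡⟨ cong (r +_) (reps-complement true false (2 * i)) ⟩
  r + δ (fold true not (2 * i)) false * ∑[ x < 2 ^ (2 * i) ] δ (χA x) true
    ≡⟨ cong (λ c → r + δ c false * ∑[ x < 2 ^ (2 * i) ] δ (χA x) true) (fold-not-even true i) ⟩
  r + 0
    ≡⟨ +-identityʳ r ⟩
  r ∎
  where
  open ≡-Reasoning
  r = reps false true (2 ^ (2 * i))

reps[2^[2+2i]] : ∀ i → reps false true (2 ^ suc (suc (2 * i))) ≡ reps false true (2 ^ (2 * i)) + 2 ^ (2 * i)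
reps[2^[2+2i]] i = begin
  reps false true (2 ^ suc (suc (2 * i)))
    ≡⟨ reps[2^[1+j]] (suc (2 * i)) ⟩
  reps false true (2 ^ suc (2 * i)) + reps true false (2 ^ suc (2 * i) ∸ 1)
    ≡⟨ cong₂ _+_ (reps[2^[1+2i]] i) (reps-complement true false (suc (2 * i))) ⟩
  r + δ (not (fold true not (2 * i))) false * ∑[ x < 2 * 2 ^ (2 * i) ] δ (χA x) true
    ≡⟨ cong₂ (λ c s → r + δ (not c) false * s) (fold-not-even true i) (χA-balanced true (2 ^ (2 * i))) ⟩
  r + 1 * 2 ^ (2 * i)
    ≡⟨ cong (r +_) (*-identityˡ (2 ^ (2 * i))) ⟩
  r + 2 ^ (2 * i) ∎
  where
  open ≡-Reasoning
  r = reps false true (2 ^ (2 * i))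

3*reps[4^i]≡4^i+2 : ∀ i → 3 * reps false true (2 ^ (2 * i)) ≡ 2 ^ (2 * i) + 2
3*reps[4^i]≡4^i+2 zero    = refl
3*reps[4^i]≡4^i+2 (suc i) = begin
  3 * reps false true (2 ^ (2 * suc i))         ≡⟨ cong (λ k → 3 * reps false true (2 ^ k)) (*-suc 2 i) ⟩
  3 * reps false true (2 ^ suc (suc (2 * i)))   ≡⟨ cong (3 *_) (reps[2^[2+2i]] i) ⟩
  3 * (r + p)                                   ≡⟨ *-distribˡ-+ 3 r p ⟩
  3 * r + 3 * p                                 ≡⟨ cong (_+ 3 * p) (3*reps[4^i]≡4^i+2 i) ⟩
  p + 2 + 3 * p                                 ≡⟨ regroup p ⟩
  2 * (2 * p) + 2                               ≡⟨ cong (λ k → 2 ^ k + 2) (*-suc 2 i) ⟨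
  2 ^ (2 * suc i) + 2                           ∎
  where
  open ≡-Reasoning
  r = reps false true (2 ^ (2 * i))
  p = 2 ^ (2 * i)
  regroup : ∀ x → x + 2 + 3 * x ≡ 2 * (2 * x) + 2
  regroup = solve-∀

[4^i+2]/3≡reps[4^i] : ∀ i → (2 ^ (2 * i) + 2) / 3 ≡ reps false true (2 ^ (2 * i))
[4^i+2]/3≡reps[4^i] i = begin
  (2 ^ (2 * i) + 2) / 3 ≡⟨ cong (_/ 3) (3*reps[4^i]≡4^i+2 i) ⟨
  3 * r / 3             ≡⟨ cong (_/ 3) (*-comm 3 r) ⟩
  r * 3 / 3             ≡⟨ m*n/n≡m r 3 ⟩
  r                     ∎
  where
  open ≡-Reasoning
  r = reps false true (2 ^ (2 * i))

R2[2^k+1]-odd : ∀ i → R2 (2 ^ suc (2 * i) + 1) ≡ (2 ^ (2 * i) + 2) / 3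
R2[2^k+1]-odd i = trans (R2[2^[1+j]+1] (2 * i)) (sym ([4^i+2]/3≡reps[4^i] i))

R2[2^k+1]-even : ∀ i → R2 (2 ^ suc (suc (2 * i)) + 1) ≡ (2 ^ (2 * i) + 2) / 3
R2[2^k+1]-even i = begin
  R2 (2 ^ suc (suc (2 * i)) + 1)      ≡⟨ R2[2^[1+j]+1] (suc (2 * i)) ⟩
  reps false true (2 ^ suc (2 * i))   ≡⟨ reps[2^[1+2i]] i ⟩
  reps false true (2 ^ (2 * i))       ≡⟨ [4^i+2]/3≡reps[4^i] i ⟨
  (2 ^ (2 * i) + 2) / 3               ∎
  where open ≡-Reasoning

theorem5 : (k : ℕ) → 1 ≤ k →
    ((k % 2 ≡ 1 → R2 (2 ^ k ∸ 1) ≡ 0) × (k % 2 ≡ 0 → R2 (2 ^ k ∸ 1) ≡ 2 ^ (k ∸ 2)))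
    × ((k % 2 ≡ 0 → R2 (2 ^ k + 1) ≡ (2 ^ (k ∸ 2) + 2) / 3) × (k % 2 ≡ 1 → R2 (2 ^ k + 1) ≡ (2 ^ (k ∸ 1) + 2) / 3))
theorem5 k 1≤k with parity k
theorem5 .(2 * zero) () | even zero
theorem5 .(2 * suc i) _ | even (suc i) =
  (⊥-elim ∘ not-odd , λ _ → at-2*[1+i] (λ k → R2 (2 ^ k ∸ 1) ≡ 2 ^ (k ∸ 2)) (R2[2^k∸1]-even i))
  , ((λ _ → at-2*[1+i] (λ k → R2 (2 ^ k + 1) ≡ (2 ^ (k ∸ 2) + 2) / 3) (R2[2^k+1]-even i)) , ⊥-elim ∘ not-odd)
  where
  not-odd : 2 * suc i % 2 ≢ 1
  not-odd = 0≢1+n ∘ trans (sym (2*n%2≡0 (suc i)))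
  -- k ∸ 2 only computes on the form suc (suc (2 * i)).
  at-2*[1+i] : (P : ℕ → Set) → P (suc (suc (2 * i))) → P (2 * suc i)
  at-2*[1+i] P = subst P (sym (*-suc 2 i))
theorem5 .(suc (2 * i)) _ | odd i =
  ((λ _ → R2[2^k∸1]-odd i) , ⊥-elim ∘ not-even) , (⊥-elim ∘ not-even , λ _ → R2[2^k+1]-odd i)
  where
  not-even : suc (2 * i) % 2 ≢ 0
  not-even = 1+n≢0 ∘ trans (sym (1+2*n%2≡1 i))
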